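{- Let $Z=Z(V_R\cup V_B)$ be a $d$-dimensional symmetric $\Pi$-zonotope with $V_R\cup V_B\subseteq V(d)$ whose graph $G$ (on $d+1$ vertices) is connected. Let $G_R$ and $G_B$ be the spanning subgraphs of $G$ on all $d+1$ vertices whose edges are the red edges (from $V_R$) and the blue edges (from $V_B$) respectively. Then $G_R$ and $G_B$ are both forests with exactly two components, and for every blue edge $e_b$ and every red edge $e_r$ the graphs $G_R\cup\{e_b\}$ and $G_B\cup\{e_r\}$ are trees. Consequently every blue edge joins the two different components of $G_R$ and every red edge joins the two different components of $G_B$.
   Context: Let $\mathbf e_1,\dots,\mathbf e_{d+1}$ be the standard basis of $\mathbb R^{d+1}$, $\mathbf e_{ij}=\mathbf e_i-\mathbf e_j$, $V(d)=\{\mathbf e_{ij}:i<j\}$, and $Z(V)=\sum_{\mathbf v\in V}[\mathbf 0,\mathbf v]$. The graph of $Z(V)$, $V\subseteq V(d)$, has vertices $1,\dots,d+1$ and an edge $\{i,j\}$ iff $\pm\mathbf e_{ij}\in V$. Two sets $V_1,V_2$ in a $d$-dimensional space, each of $d-1$ vectors spanning a $(d-1)$-dimensional subspace, are conjugate if for all $\mathbf u_1\in V_1,\mathbf u_2\in V_2$ both $\{\mathbf u_1\}\cup V_2$ and $\{\mathbf u_2\}\cup V_1$ span $d$-dimensional spaces; $Z(V_R\cup V_B)$ is a symmetric $\Pi$-zonotope if $V_R,V_B$ are conjugate in the linear span of $V_R\cup V_B$. Edges of $G$ coming from $V_R$ are called red, those from $V_B$ blue. -}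

module Defs where

open import Data.Nat using (ℕ; zero; suc; _≤_)
open import Data.Fin using (Fin; _<_; _≟_)
open import Data.Product using (Σ; ∃; _×_; _,_; proj₁; proj₂)
open import Data.Sum using (_⊎_)
open import Data.List using (List; []; _∷_; _++_; length; map)
open import Data.List.Membership.Propositional using (_∈_)
open import Data.List.Relation.Unary.All using (All)
open import Data.List.Relation.Unary.Unique.Propositional using (Unique)
open import Data.List.Relation.Unary.Linked using (Linked)
open import Data.Rational using (ℚ; 0ℚ; 1ℚ; -_; _+_; _*_)
open import Relation.Binary.PropositionalEquality using (_≡_)
open import Relation.Binary.Construct.Closure.ReflexiveTransitive using (Star)
open import Relation.Nullary using (¬_; yes; no)

Vect : ℕ → Set
Vect n = Fin n → ℚ

sumFin : ∀ {m} → (Fin m → ℚ) → ℚ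
sumFin {zero}  f = 0ℚ
sumFin {suc m} f = f Data.Fin.zero + sumFin (λ k → f (Data.Fin.suc k))


combo : ∀ {n m} → (Fin m → Vect n) → (Fin m → ℚ) → Vect n
combo b c x = sumFin (λ k → c k * b k x)

LinIndep : ∀ {n m} → (Fin m → Vect n) → Set
LinIndep b = ∀ c → (∀ x → combo b c x ≡ 0ℚ) → ∀ k → c k ≡ 0ℚ

InSpanF : ∀ {n m} → (Fin m → Vect n) → Vect n → Set
InSpanF b v = ∃ λ c → ∀ x → combo b c x ≡ v x

InSpan : ∀ {n} → List (Vect n) → Vect n → Set
InSpan vs v = ∃ λ c → ∀ x → combo (Data.List.lookup vs) c x ≡ v x

SpanDim : ∀ {n} → List (Vect n) → ℕ → Set
SpanDim {n} vs k =
  Σ (Fin k → Vect n) λ b →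
    LinIndep b × (∀ i → InSpan vs (b i)) × All (InSpanF b) vs

Vertex : ℕ → Set
Vertex d = Fin (suc d)

Edge : ℕ → Set
Edge d = Vertex d × Vertex d

𝐞 : ∀ {n} → Fin n → Vect n
𝐞 i x with i ≟ x
... | yes _ = 1ℚ
... | no  _ = 0ℚ

eVec : ∀ {d} → Edge d → Vect (suc d)
eVec (i , j) x = 𝐞 i x + (- 𝐞 j x)

-- a set V ⊆ V(d), given as a duplicate-free list of pairs (i , j) with i < j
InVd : ∀ {d} → List (Edge d) → Set
InVd V = All (λ e → proj₁ e < proj₂ e) V × Unique V

vecs : ∀ {d} → List (Edge d) → List (Vect (suc d))
vecs = map eVec

-- Two sets V₁, V₂ (of d-1 vectors each, spanning (d-1)-dimensional spaces)
-- are conjugate in a d-dimensional space.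
Conjugate : ∀ {n} → ℕ → List (Vect n) → List (Vect n) → Set
Conjugate d V₁ V₂ =
  (∀ {u₁} → u₁ ∈ V₁ → SpanDim (u₁ ∷ V₂) d) ×
  (∀ {u₂} → u₂ ∈ V₂ → SpanDim (u₂ ∷ V₁) d)

Adj : ∀ {d} → List (Edge d) → Vertex d → Vertex d → Set
Adj E x y = (x , y) ∈ E ⊎ (y , x) ∈ E

Connected : ∀ {d} → List (Edge d) → Vertex d → Vertex d → Set
Connected E = Star (Adj E)

IsConnected : ∀ {d} → List (Edge d) → Set
IsConnected E = ∀ x y → Connected E x y

lastOr : ∀ {A : Set} → A → List A → A
lastOr a []       = a
lastOr a (x ∷ xs) = lastOr x xs

Cycle : ∀ {d} → List (Edge d) → Set
Cycle {d} E = Σ (Vertex d) λ v₀ → Σ (List (Vertex d)) λ vs →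
  2 ≤ length vs × Unique (v₀ ∷ vs) × Linked (Adj E) (v₀ ∷ vs) ×
  Adj E (lastOr v₀ vs) v₀

Forest : ∀ {d} → List (Edge d) → Set
Forest E = ¬ Cycle E

Tree : ∀ {d} → List (Edge d) → Set
Tree E = IsConnected E × Forest E

TwoComponents : ∀ {d} → List (Edge d) → Set
TwoComponents E = Σ _ λ a → Σ _ λ b →
  ¬ Connected E a b × (∀ x → Connected E x a ⊎ Connected E x b)

-- For a blue edge e, the vector e together with the
-- d - 1 red vectors spans a d-dimensional space, so these d edge vectors
-- e_ij = e_i - e_j are linearly independent.  The edge vector of the ends of a
-- walk is the signed sum of the edge vectors along it, so independent edge
-- vectors form an independent set of the graphic matroid: no edge has its
-- ends joined by a walk through the other edges.  Hence e ∪ V_R has no cycle;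
-- V_R is a forest with d - 1 edges on d + 1 vertices, i.e. with two
-- components; e is not inside a component, so it joins the two, and e ∪ V_R
-- is a spanning tree.  The same holds with the colours exchanged.

module Submission where

open import Defs
open import Algebra.Bundles using (CommutativeRing)
open import Data.Nat as Nat using (ℕ; zero; suc; _≤_; _∸_; z≤n; s≤s; _≤?_) renaming (_<_ to _<ℕ_)
import Data.Nat.Properties as ℕP
open import Data.Fin using (Fin; punchIn) renaming (zero to fzero; suc to fsuc)
import Data.Fin.Properties as FinP
open import Data.Vec.Functional using (insertAt)
open import Data.Vec.Functional.Properties using (insertAt-lookup; insertAt-punchIn)
open import Data.Product using (_×_; _,_; ∃; proj₁; proj₂)
open import Data.Sum as Sum using (_⊎_; inj₁; inj₂)
open import Data.List using (List; []; _∷_; length; _++_; lookup; allFin)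
open import Data.List.Relation.Unary.All as All using (All; _∷_)
open import Data.List.Relation.Unary.AllPairs using (_∷_)
open import Data.List.Relation.Unary.Linked using (Linked; _∷_)
open import Data.List.Properties using (length-map; length-++-sucʳ; length-tabulate)
open import Data.List.Membership.Propositional using (_∈_; find; lose)
open import Data.List.Membership.Propositional.Properties
  using (∈-lookup; ∈-map⁺; ∈-map⁻; ∈-++⁺ˡ; ∈-++⁺ʳ; ∈-++⁻; ∈-∃++; ∈-allFin)
open import Data.List.Relation.Unary.Any as Any using (Any; here; there; index)
import Data.List.Relation.Unary.Any.Properties as AnyP
open import Data.Rational using (ℚ; 0ℚ; 1ℚ; -_; _+_; _-_; _*_; 1/_; ≢-nonZero)
import Data.Rational.Properties as ℚP
open import Data.Rational.Solver using (module +-*-Solver)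
open import Function using (_∘_; id)
open import Relation.Binary.PropositionalEquality
import Relation.Binary.Construct.Closure.ReflexiveTransitive as Star
open Star using (ε; _◅_; _◅◅_)
open import Relation.Nullary using (¬_; ¬?; yes; no; contradiction)
open import Relation.Nullary.Decidable using (decidable-stable)

open import Algebra.Properties.Semiring.Sum (CommutativeRing.semiring ℚP.+-*-commutativeRing)
  using (sum; sum-cong-≗; ∑-distrib-+; ∑-comm; sum-remove; *-distribˡ-sum; *-distribʳ-sum; sum-replicate-zero)
open +-*-Solver using (solve; _:+_; _:*_; :-_; _:=_; con)
open ≡-Reasoning

sumFin≡sum : ∀ {m} (f : Fin m → ℚ) → sumFin f ≡ sum f
sumFin≡sum {zero}  f = refl
sumFin≡sum {suc m} f = cong (f fzero +_) (sumFin≡sum (λ k → f (fsuc k)))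

sum-zero : ∀ {m} (f : Fin m → ℚ) → (∀ k → f k ≡ 0ℚ) → sum f ≡ 0ℚ
sum-zero {m} f f≡0 = trans (sum-cong-≗ f≡0) (sum-replicate-zero m)

sum-reassociate : ∀ {k m} (c : Fin k → ℚ) (A : Fin k → Fin m → ℚ) (w : Fin m → ℚ) →
  sum (λ i → c i * sum (λ l → A i l * w l)) ≡ sum (λ l → sum (λ i → c i * A i l) * w l)
sum-reassociate c A w = begin
  sum (λ i → c i * sum (λ l → A i l * w l))
    ≡⟨ sum-cong-≗ (λ i → *-distribˡ-sum (c i) (λ l → A i l * w l)) ⟩
  sum (λ i → sum (λ l → c i * (A i l * w l)))
    ≡⟨ sum-cong-≗ (λ i → sum-cong-≗ (λ l → sym (ℚP.*-assoc (c i) (A i l) (w l)))) ⟩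
  sum (λ i → sum (λ l → c i * A i l * w l))
    ≡⟨ ∑-comm (λ i l → c i * A i l * w l) ⟩
  sum (λ l → sum (λ i → c i * A i l * w l))
    ≡⟨ sum-cong-≗ (λ l → sym (*-distribʳ-sum (w l) (λ i → c i * A i l))) ⟩
  sum (λ l → sum (λ i → c i * A i l) * w l)
    ∎

𝐞-diagonal : ∀ {m} (l : Fin m) → 𝐞 l l ≡ 1ℚ
𝐞-diagonal l with l FinP.≟ l
... | yes _   = refl
... | no l≢l = contradiction refl l≢l

𝐞-offDiagonal : ∀ {m} {l k : Fin m} → ¬ l ≡ k → 𝐞 l k ≡ 0ℚ
𝐞-offDiagonal {l = l} {k} l≢k with l FinP.≟ k
... | yes l≡k = contradiction l≡k l≢k
... | no _    = refl

sum-select : ∀ {m} (l : Fin m) (f : Fin m → ℚ) → sum (λ k → 𝐞 l k * f k) ≡ f l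
sum-select {suc m} l f = begin
  sum (λ k → 𝐞 l k * f k)
    ≡⟨ sum-remove {i = l} (λ k → 𝐞 l k * f k) ⟩
  𝐞 l l * f l + sum (λ k → 𝐞 l (punchIn l k) * f (punchIn l k))
    ≡⟨ cong₂ _+_ (cong (_* f l) (𝐞-diagonal l))
                 (sum-zero _ (λ k → trans (cong (_* f (punchIn l k)) (𝐞-offDiagonal (FinP.punchInᵢ≢i l k ∘ sym)))
                                          (ℚP.*-zeroˡ (f (punchIn l k))))) ⟩
  1ℚ * f l + 0ℚ
    ≡⟨ trans (ℚP.+-identityʳ (1ℚ * f l)) (ℚP.*-identityˡ (f l)) ⟩
  f l
    ∎

combo≡sum : ∀ {n m} (b : Fin m → Vect n) (c : Fin m → ℚ) x → combo b c x ≡ sum (λ k → c k * b k x)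
combo≡sum {m = m} b c x = sumFin≡sum {m} (λ k → c k * b k x)

span-zero : ∀ {n m} (b : Fin m → Vect n) → InSpanF b (λ _ → 0ℚ)
span-zero b = (λ _ → 0ℚ) , λ x →
  trans (combo≡sum b (λ _ → 0ℚ) x) (sum-zero _ (λ k → ℚP.*-zeroˡ (b k x)))

span-+ : ∀ {n m} {b : Fin m → Vect n} {u v : Vect n} →
  InSpanF b u → InSpanF b v → InSpanF b (λ x → u x + v x)
span-+ {b = b} {u} {v} (c₁ , c₁↦u) (c₂ , c₂↦v) = (λ k → c₁ k + c₂ k) , λ x → begin
  combo b (λ k → c₁ k + c₂ k) x
    ≡⟨ combo≡sum b (λ k → c₁ k + c₂ k) x ⟩
  sum (λ k → (c₁ k + c₂ k) * b k x)
    ≡⟨ sum-cong-≗ (λ k → ℚP.*-distribʳ-+ (b k x) (c₁ k) (c₂ k)) ⟩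
  sum (λ k → c₁ k * b k x + c₂ k * b k x)
    ≡⟨ ∑-distrib-+ (λ k → c₁ k * b k x) (λ k → c₂ k * b k x) ⟩
  sum (λ k → c₁ k * b k x) + sum (λ k → c₂ k * b k x)
    ≡⟨ sym (cong₂ _+_ (combo≡sum b c₁ x) (combo≡sum b c₂ x)) ⟩
  combo b c₁ x + combo b c₂ x
    ≡⟨ cong₂ _+_ (c₁↦u x) (c₂↦v x) ⟩
  u x + v x
    ∎

span-neg : ∀ {n m} {b : Fin m → Vect n} {v : Vect n} → InSpanF b v → InSpanF b (λ x → - v x)
span-neg {b = b} {v} (c , c↦v) = (λ k → - c k) , λ x → begin
  combo b (λ k → - c k) x
    ≡⟨ combo≡sum b (λ k → - c k) x ⟩
  sum (λ k → - c k * b k x)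
    ≡⟨ sum-cong-≗ (λ k → solve 2 (λ a y → (:- a) :* y := (:- con 1ℚ) :* (a :* y)) refl (c k) (b k x)) ⟩
  sum (λ k → - 1ℚ * (c k * b k x))
    ≡⟨ sym (*-distribˡ-sum (- 1ℚ) (λ k → c k * b k x)) ⟩
  - 1ℚ * sum (λ k → c k * b k x)
    ≡⟨ cong (- 1ℚ *_) (trans (sym (combo≡sum b c x)) (c↦v x)) ⟩
  - 1ℚ * v x
    ≡⟨ solve 1 (λ y → (:- con 1ℚ) :* y := :- y) refl (v x) ⟩
  - v x
    ∎

span-resp : ∀ {n m} {b : Fin m → Vect n} {u v : Vect n} → InSpanF b u → (∀ x → u x ≡ v x) → InSpanF b v
span-resp (c , c↦u) u≗v = c , λ x → trans (c↦u x) (u≗v x)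

span-basis : ∀ {n m} (b : Fin m → Vect n) (l : Fin m) → InSpanF b (b l)
span-basis b l = 𝐞 l , λ x → trans (combo≡sum b (𝐞 l) x) (sum-select l (λ k → b k x))

span-member : ∀ {n} {L : List (Vect n)} {v : Vect n} → v ∈ L → InSpan L v
span-member {L = L} v∈L = subst (InSpan L) (sym (AnyP.lookup-index v∈L)) (span-basis (lookup L) (index v∈L))

span-trans : ∀ {n k m} {b : Fin k → Vect n} {w : Fin m → Vect n} {v : Vect n} →
  InSpanF b v → (∀ i → InSpanF w (b i)) → InSpanF w v
span-trans {k = k} {m = m} {b = b} {w} {v} (c , c↦v) b⊆w = (λ l → sum (λ i → c i * A i l)) , λ x → begin
  combo w (λ l → sum (λ i → c i * A i l)) x
    ≡⟨ combo≡sum w (λ l → sum (λ i → c i * A i l)) x ⟩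
  sum (λ l → sum (λ i → c i * A i l) * w l x)
    ≡⟨ sym (sum-reassociate c A (λ l → w l x)) ⟩
  sum (λ i → c i * sum (λ l → A i l * w l x))
    ≡⟨ sum-cong-≗ (λ i → cong (c i *_) (trans (sym (combo≡sum w (A i) x)) (proj₂ (b⊆w i) x))) ⟩
  sum (λ i → c i * b i x)
    ≡⟨ trans (sym (combo≡sum b c x)) (c↦v x) ⟩
  v x
    ∎
  where
  A : Fin k → Fin m → ℚ
  A i = proj₁ (b⊆w i)

Solves : ∀ {k m} → (Fin k → Fin m → ℚ) → (Fin k → ℚ) → Set
Solves M c = ∀ l → sum (λ i → c i * M i l) ≡ 0ℚ

Nontrivial : ∀ {k} → (Fin k → ℚ) → Set
Nontrivial c = ∃ λ i → ¬ c i ≡ 0ℚ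

reduceRows : ∀ {k m} → (Fin (suc k) → Fin m → ℚ) → Fin (suc k) → (Fin k → ℚ) → Fin k → Fin m → ℚ
reduceRows M j a i l = M (punchIn j i) l - a i * M j l

liftCoefficients : ∀ {k} → Fin (suc k) → (Fin k → ℚ) → (Fin k → ℚ) → Fin (suc k) → ℚ
liftCoefficients j a c' = insertAt c' j (- sum (λ i → c' i * a i))

combination-reduceRows : ∀ {k m} (M : Fin (suc k) → Fin m → ℚ) j (a c' : Fin k → ℚ) l →
  sum (λ i → liftCoefficients j a c' i * M i l) ≡ sum (λ i → c' i * reduceRows M j a i l)
combination-reduceRows M j a c' l = begin
  sum (λ i → c i * M i l)
    ≡⟨ sum-remove {i = j} (λ i → c i * M i l) ⟩
  c j * M j l + sum (λ i → c (punchIn j i) * M (punchIn j i) l)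
    ≡⟨ cong₂ _+_ (cong (_* M j l) (insertAt-lookup c' j γ))
                 (sum-cong-≗ (λ i → cong (_* M (punchIn j i) l) (insertAt-punchIn c' j γ i))) ⟩
  γ * M j l + sum (λ i → c' i * M (punchIn j i) l)
    ≡⟨ cong (_+ sum (λ i → c' i * M (punchIn j i) l))
            (solve 2 (λ s y → (:- s) :* y := s :* (:- y)) refl S (M j l)) ⟩
  S * - M j l + sum (λ i → c' i * M (punchIn j i) l)
    ≡⟨ cong (_+ sum (λ i → c' i * M (punchIn j i) l)) (*-distribʳ-sum (- M j l) (λ i → c' i * a i)) ⟩
  sum (λ i → c' i * a i * - M j l) + sum (λ i → c' i * M (punchIn j i) l)
    ≡⟨ sym (∑-distrib-+ (λ i → c' i * a i * - M j l) (λ i → c' i * M (punchIn j i) l)) ⟩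
  sum (λ i → c' i * a i * - M j l + c' i * M (punchIn j i) l)
    ≡⟨ sum-cong-≗ (λ i → solve 4 (λ x y z w → x :* y :* (:- z) :+ x :* w := x :* (w :+ :- (y :* z)))
                                  refl (c' i) (a i) (M j l) (M (punchIn j i) l)) ⟩
  sum (λ i → c' i * reduceRows M j a i l)
    ∎
  where
  S = sum (λ i → c' i * a i)
  γ = - S
  c = liftCoefficients j a c'

pivotRatios : ∀ {k m} (M : Fin (suc k) → Fin (suc m) → ℚ) j → ¬ M j fzero ≡ 0ℚ → Fin k → ℚ
pivotRatios M j p≢0 i = M (punchIn j i) fzero * 1/_ (M j fzero) {{≢-nonZero p≢0}}

reduceRows-pivotColumn : ∀ {k m} (M : Fin (suc k) → Fin (suc m) → ℚ) j (p≢0 : ¬ M j fzero ≡ 0ℚ) i →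
  reduceRows M j (pivotRatios M j p≢0) i fzero ≡ 0ℚ
reduceRows-pivotColumn M j p≢0 i = begin
  x - x * p⁻¹ * p     ≡⟨ cong (λ y → x - y) (ℚP.*-assoc x p⁻¹ p) ⟩
  x - x * (p⁻¹ * p)   ≡⟨ cong (λ y → x - x * y) (ℚP.*-inverseˡ (M j fzero) {{≢-nonZero p≢0}}) ⟩
  x - x * 1ℚ          ≡⟨ solve 1 (λ y → y :+ :- (y :* con 1ℚ) := con 0ℚ) refl x ⟩
  0ℚ                  ∎
  where
  x = M (punchIn j i) fzero
  p = M j fzero
  p⁻¹ = 1/_ p {{≢-nonZero p≢0}}

pivot-step : ∀ {k m} (M : Fin (suc k) → Fin (suc m) → ℚ) j (p≢0 : ¬ M j fzero ≡ 0ℚ) {c' : Fin k → ℚ} →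
  Solves (λ i l → reduceRows M j (pivotRatios M j p≢0) i (fsuc l)) c' →
  Solves M (liftCoefficients j (pivotRatios M j p≢0) c')
pivot-step M j p≢0 {c'} solves fzero =
  trans (combination-reduceRows M j (pivotRatios M j p≢0) c' fzero)
        (sum-zero _ (λ i → trans (cong (c' i *_) (reduceRows-pivotColumn M j p≢0 i)) (ℚP.*-zeroʳ (c' i))))
pivot-step M j p≢0 {c'} solves (fsuc l) =
  trans (combination-reduceRows M j (pivotRatios M j p≢0) c' (fsuc l)) (solves l)

liftCoefficients-nontrivial : ∀ {k} j (a c' : Fin k → ℚ) → Nontrivial c' → Nontrivial (liftCoefficients j a c')
liftCoefficients-nontrivial j a c' (i , c'ᵢ≢0) =
  punchIn j i , λ cᵢ≡0 → c'ᵢ≢0 (trans (sym (insertAt-punchIn c' j _ i)) cᵢ≡0)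

zeroColumn-step : ∀ {k m} (M : Fin k → Fin (suc m) → ℚ) {c : Fin k → ℚ} → (∀ i → M i fzero ≡ 0ℚ) →
  Solves (λ i l → M i (fsuc l)) c → Solves M c
zeroColumn-step M {c} column≡0 solves fzero =
  sum-zero _ (λ i → trans (cong (c i *_) (column≡0 i)) (ℚP.*-zeroʳ (c i)))
zeroColumn-step M column≡0 solves (fsuc l) = solves l

homogeneous-nontrivial : ∀ m {k} → m <ℕ k → (M : Fin k → Fin m → ℚ) →
  ∃ λ c → Nontrivial c × Solves M c
homogeneous-nontrivial zero {suc k} _ M = (λ _ → 1ℚ) , (fzero , λ ()) , λ ()
homogeneous-nontrivial (suc m) {suc k} (s≤s m<k) M
  with FinP.any? (λ j → ¬? (M j fzero ℚP.≟ 0ℚ))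
... | yes (j , p≢0) =
  let a = pivotRatios M j p≢0
      c' , nontrivial , solves = homogeneous-nontrivial m m<k (λ i l → reduceRows M j a i (fsuc l))
  in liftCoefficients j a c' , liftCoefficients-nontrivial j a c' nontrivial , pivot-step M j p≢0 solves
... | no noPivot =
  let c , nontrivial , solves = homogeneous-nontrivial m (ℕP.m<n⇒m<1+n m<k) (λ i l → M i (fsuc l))
  in c , nontrivial ,
     zeroColumn-step M {c} (λ i → decidable-stable (M i fzero ℚP.≟ 0ℚ) (λ p≢0 → noPivot (i , p≢0))) solves

-- Otherwise the k × m coefficient matrix has a
-- nontrivial left kernel vector, which is a dependence among the k vectors.
independent-in-span-bound : ∀ {n k m} (b : Fin k → Vect n) (w : Fin m → Vect n) →
  LinIndep b → (∀ i → InSpanF w (b i)) → k ≤ m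
independent-in-span-bound {k = k} {m} b w independent b⊆w with k ≤? m
... | yes k≤m = k≤m
... | no k≰m with homogeneous-nontrivial m (ℕP.≰⇒> k≰m) (λ i → proj₁ (b⊆w i))
...   | c , (i , cᵢ≢0) , solves = contradiction (independent c dependence i) cᵢ≢0
  where
  A : Fin k → Fin m → ℚ
  A i = proj₁ (b⊆w i)
  dependence : ∀ x → combo b c x ≡ 0ℚ
  dependence x = begin
    combo b c x
      ≡⟨ combo≡sum b c x ⟩
    sum (λ i → c i * b i x)
      ≡⟨ sum-cong-≗ (λ i → cong (c i *_) (trans (sym (proj₂ (b⊆w i) x)) (combo≡sum w (A i) x))) ⟩
    sum (λ i → c i * sum (λ l → A i l * w l x))
      ≡⟨ sum-reassociate c A (λ l → w l x) ⟩
    sum (λ l → sum (λ i → c i * A i l) * w l x)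
      ≡⟨ sum-zero _ (λ l → trans (cong (_* w l x) (solves l)) (ℚP.*-zeroˡ (w l x))) ⟩
    0ℚ
      ∎

spanDim-bound : ∀ {n k} {L L' : List (Vect n)} →
  SpanDim L k → (∀ {v} → v ∈ L → InSpan L' v) → k ≤ length L'
spanDim-bound {L' = L'} (b , independent , b⊆L , _) L⊆L' =
  independent-in-span-bound b (lookup L') independent (λ i → span-trans (b⊆L i) (λ l → L⊆L' (∈-lookup l)))

module _ {d : ℕ} where

  adj-sym : ∀ {E : List (Edge d)} {x y} → Adj E x y → Adj E y x
  adj-sym (inj₁ xy∈E) = inj₂ xy∈E
  adj-sym (inj₂ yx∈E) = inj₁ yx∈E

  connected-sym : ∀ {E : List (Edge d)} {x y} → Connected E x y → Connected E y x
  connected-sym = Star.reverse adj-sym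

  connected-mono : ∀ {E E' : List (Edge d)} → (∀ {f} → f ∈ E → f ∈ E') →
    ∀ {x y} → Connected E x y → Connected E' x y
  connected-mono E⊆E' = Star.map (Sum.map E⊆E' E⊆E')

  edge-connected : ∀ {E : List (Edge d)} {f} → f ∈ E → Connected E (proj₁ f) (proj₂ f)
  edge-connected f∈E = inj₁ f∈E ◅ ε

  -- The edge vector of a pair joined by a walk in E is the signed sum of the
  -- edge vectors along the walk (telescoping e_xz = e_xy + e_yz, e_yx = -e_xy).
  connected-span : ∀ {E : List (Edge d)} {x y} → Connected E x y → InSpan (vecs E) (eVec (x , y))
  connected-span {E} {x} ε =
    span-resp (span-zero (lookup (vecs E))) (λ w → sym (ℚP.+-inverseʳ (𝐞 x w)))
  connected-span {E} {x} {z} (_◅_ {j = y} step walk) =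
    span-resp (span-+ (step-span step) (connected-span walk)) telescope
    where
    telescope : ∀ w → eVec (x , y) w + eVec (y , z) w ≡ eVec (x , z) w
    telescope w = solve 3 (λ a b c → (a :+ :- b) :+ (b :+ :- c) := a :+ :- c) refl (𝐞 x w) (𝐞 y w) (𝐞 z w)
    step-span : Adj E x y → InSpan (vecs E) (eVec (x , y))
    step-span (inj₁ xy∈E) = span-member (∈-map⁺ eVec xy∈E)
    step-span (inj₂ yx∈E) = span-resp (span-neg (span-member (∈-map⁺ eVec yx∈E))) reverse
      where
      reverse : ∀ w → - eVec (y , x) w ≡ eVec (x , y) w
      reverse w = solve 2 (λ a b → :- (b :+ :- a) := a :+ :- b) refl (𝐞 x w) (𝐞 y w)

  rank-bound : ∀ {k} {E E' : List (Edge d)} → SpanDim (vecs E) k →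
    (∀ {f} → f ∈ E → Connected E' (proj₁ f) (proj₂ f)) → k ≤ length E'
  rank-bound {k} {E} {E'} dim E⇝E' = subst (k ≤_) (length-map eVec E') (spanDim-bound {L' = vecs E'} dim vecs-in-span)
    where
    vecs-in-span : ∀ {v} → v ∈ vecs E → InSpan (vecs E') v
    vecs-in-span v∈ with ∈-map⁻ eVec v∈
    ... | f , f∈E , refl = connected-span (E⇝E' f∈E)

  EdgeIndependent : List (Edge d) → Set
  EdgeIndependent E = ∀ P e Q → E ≡ P ++ e ∷ Q → ¬ Connected (P ++ Q) (proj₁ e) (proj₂ e)

  -- Linearly independent edge vectors form an independent edge set: a walk
  -- avoiding e would put all |E| vectors in the span of the other |E| - 1.
  independent-edges : ∀ {E : List (Edge d)} → SpanDim (vecs E) (length E) → EdgeIndependent E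
  independent-edges dim P e Q refl e-walk =
    ℕP.n≮n _ (subst (_≤ length (P ++ Q)) (length-++-sucʳ P e Q) (rank-bound dim covered))
    where
    covered : ∀ {f} → f ∈ P ++ e ∷ Q → Connected (P ++ Q) (proj₁ f) (proj₂ f)
    covered f∈ with ∈-++⁻ P f∈
    ... | inj₁ f∈P         = edge-connected (∈-++⁺ˡ f∈P)
    ... | inj₂ (here refl) = e-walk
    ... | inj₂ (there f∈Q) = edge-connected (∈-++⁺ʳ P f∈Q)

  independent-head : ∀ {e} {E : List (Edge d)} → EdgeIndependent (e ∷ E) → ¬ Connected E (proj₁ e) (proj₂ e)
  independent-head independent = independent [] _ _ refl

  independent-tail : ∀ {e} {E : List (Edge d)} → EdgeIndependent (e ∷ E) → EdgeIndependent E
  independent-tail {e} independent P f Q refl walk =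
    independent (e ∷ P) f Q refl (connected-mono there walk)

  RedundantEdge : List (Edge d) → Set
  RedundantEdge E = ∃ λ P → ∃ λ e → ∃ λ Q → E ≡ P ++ e ∷ Q × Connected (P ++ Q) (proj₁ e) (proj₂ e)

  Touches : Edge d → Vertex d → Set
  Touches e v = proj₁ e ≡ v ⊎ proj₂ e ≡ v

  ∈-without : ∀ P Q e {v a b} → Touches e v → ¬ v ≡ a → ¬ v ≡ b →
    (a , b) ∈ P ++ e ∷ Q → (a , b) ∈ P ++ Q
  ∈-without P Q e touches v≢a v≢b ab∈ with ∈-++⁻ P ab∈ | touches
  ... | inj₁ ab∈P         | _         = ∈-++⁺ˡ ab∈P
  ... | inj₂ (there ab∈Q) | _         = ∈-++⁺ʳ P ab∈Q
  ... | inj₂ (here refl)  | inj₁ refl = contradiction refl v≢a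
  ... | inj₂ (here refl)  | inj₂ refl = contradiction refl v≢b

  adj-avoiding : ∀ P Q e {v x y} → Touches e v → ¬ v ≡ x → ¬ v ≡ y →
    Adj (P ++ e ∷ Q) x y → Adj (P ++ Q) x y
  adj-avoiding P Q e touches v≢x v≢y =
    Sum.map (∈-without P Q e touches v≢x v≢y) (∈-without P Q e touches v≢y v≢x)

  walk-avoiding : ∀ P Q e {v} → Touches e v → ∀ y ys → All (λ z → ¬ v ≡ z) (y ∷ ys) →
    Linked (Adj (P ++ e ∷ Q)) (y ∷ ys) → Connected (P ++ Q) y (lastOr y ys)
  walk-avoiding P Q e touches y []        _                  _               = ε
  walk-avoiding P Q e touches y (y' ∷ ys) (v≢y ∷ avoids) (step ∷ linked) =
    adj-avoiding P Q e touches v≢y (All.head avoids) step ◅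
    walk-avoiding P Q e touches y' ys avoids linked

  lastOr-member : ∀ (a b : Vertex d) bs → lastOr a (b ∷ bs) ∈ b ∷ bs
  lastOr-member a b []       = here refl
  lastOr-member a b (c ∷ cs) = there (lastOr-member b c cs)

  -- In a cycle v₀ w₁ … ℓ the closing edge e = {ℓ, v₀} is redundant: the path
  -- v₀ w₁ … ℓ avoids e, its first step avoiding ℓ and all later steps avoiding v₀.
  cycle-redundant : ∀ {E : List (Edge d)} → Cycle E → RedundantEdge E
  cycle-redundant (v₀ , []          , ()      , _)
  cycle-redundant (v₀ , w₁ ∷ []     , s≤s () , _)
  cycle-redundant {E} (v₀ , w₁ ∷ w₂ ∷ ws , _ , (v₀≢ ∷ w₁≢ ∷ _) , (first ∷ linked) , closing) =
    split closing
    where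
    ℓ = lastOr w₁ (w₂ ∷ ws)
    v₀≢ℓ : ¬ v₀ ≡ ℓ
    v₀≢ℓ = All.lookup v₀≢ (there (lastOr-member w₁ w₂ ws))
    w₁≢ℓ : ¬ w₁ ≡ ℓ
    w₁≢ℓ = All.lookup w₁≢ (lastOr-member w₁ w₂ ws)
    path : ∀ P e Q → E ≡ P ++ e ∷ Q → Touches e v₀ → Touches e ℓ → Connected (P ++ Q) v₀ ℓ
    path P e Q refl at-v₀ at-ℓ =
      adj-avoiding P Q e at-ℓ (≢-sym v₀≢ℓ) (≢-sym w₁≢ℓ) first ◅
      walk-avoiding P Q e at-v₀ w₁ (w₂ ∷ ws) v₀≢ linked
    split : Adj E ℓ v₀ → RedundantEdge E
    split (inj₁ ℓv₀∈E) with ∈-∃++ ℓv₀∈E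
    ... | P , Q , refl = P , (ℓ , v₀) , Q , refl , connected-sym (path P _ Q refl (inj₂ refl) (inj₁ refl))
    split (inj₂ v₀ℓ∈E) with ∈-∃++ v₀ℓ∈E
    ... | P , Q , refl = P , (v₀ , ℓ) , Q , refl , path P _ Q refl (inj₁ refl) (inj₂ refl)

  independent-forest : ∀ {E : List (Edge d)} → EdgeIndependent E → Forest E
  independent-forest independent cycle with cycle-redundant cycle
  ... | P , e , Q , E≡ , walk = independent P e Q E≡ walk

  -- By induction: an
  -- independent edge joins two different components, so one of their
  -- representatives can be dropped.
  component-representatives : ∀ (E : List (Edge d)) → EdgeIndependent E →
    ∃ λ R → length E Nat.+ length R ≡ suc d × (∀ x → Any (Connected E x) R)
  component-representatives [] _ =
    allFin (suc d) , length-tabulate id , λ x → lose (∈-allFin x) ε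
  component-representatives ((u , v) ∷ E) independent
    with component-representatives E (independent-tail independent)
  ... | R , counted , covers with find (covers u) | find (covers v)
  ... | ru , ru∈R , u~ru | rv , rv∈R , v~rv with ∈-∃++ rv∈R
  ... | A , B , refl = A ++ B , counted′ , covers′
    where
    E′ = (u , v) ∷ E
    widen : ∀ {x y} → Connected E x y → Connected E′ x y
    widen = connected-mono there
    ru≢rv : ¬ ru ≡ rv
    ru≢rv refl = independent-head independent (u~ru ◅◅ connected-sym v~rv)
    ru∈A++B : ru ∈ A ++ B
    ru∈A++B with ∈-++⁻ A ru∈R
    ... | inj₁ ru∈A          = ∈-++⁺ˡ ru∈A
    ... | inj₂ (here ru≡rv)  = contradiction ru≡rv ru≢rv
    ... | inj₂ (there ru∈B)  = ∈-++⁺ʳ A ru∈B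
    rv~ru : Connected E′ rv ru
    rv~ru = widen (connected-sym v~rv) ◅◅ (inj₂ (here refl) ◅ widen u~ru)
    covers′ : ∀ x → Any (Connected E′ x) (A ++ B)
    covers′ x with AnyP.++⁻ A (covers x)
    ... | inj₁ x~A           = AnyP.++⁺ˡ (Any.map widen x~A)
    ... | inj₂ (here x~rv)   = lose ru∈A++B (widen x~rv ◅◅ rv~ru)
    ... | inj₂ (there x~B)   = AnyP.++⁺ʳ A (Any.map widen x~B)
    counted′ : suc (length E) Nat.+ length (A ++ B) ≡ suc d
    counted′ = begin
      suc (length E) Nat.+ length (A ++ B)   ≡⟨ sym (ℕP.+-suc (length E) (length (A ++ B))) ⟩
      length E Nat.+ suc (length (A ++ B))   ≡⟨ cong (length E Nat.+_) (sym (length-++-sucʳ A rv B)) ⟩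
      length E Nat.+ length (A ++ rv ∷ B)    ≡⟨ counted ⟩
      suc d                                  ∎

  CoveredBy : List (Edge d) → Vertex d → Vertex d → Set
  CoveredBy E a b = ∀ x → Connected E x a ⊎ Connected E x b

  two-representatives : ∀ (E : List (Edge d)) → suc (length E) ≡ d → EdgeIndependent E →
    ∃ λ a → ∃ λ b → CoveredBy E a b
  two-representatives E |E|+1≡d independent with component-representatives E independent
  ... | R , counted , covers = pair R (ℕP.+-cancelˡ-≡ (length E) (length R) 2 counted′) covers
    where
    counted′ : length E Nat.+ length R ≡ length E Nat.+ 2
    counted′ = trans counted (trans (cong suc (sym |E|+1≡d)) (ℕP.+-comm 2 (length E)))
    pair : ∀ R → length R ≡ 2 → (∀ x → Any (Connected E x) R) → ∃ λ a → ∃ λ b → CoveredBy E a b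
    pair (a ∷ b ∷ []) _ covers = a , b , λ x → covered (covers x)
      where
      covered : ∀ {x} → Any (Connected E x) (a ∷ b ∷ []) → Connected E x a ⊎ Connected E x b
      covered (here x~a)         = inj₁ x~a
      covered (there (here x~b)) = inj₂ x~b
    pair []                () _
    pair (_ ∷ [])          () _
    pair (_ ∷ _ ∷ _ ∷ _)   () _

  covered-connected : ∀ {E E' : List (Edge d)} {a b} → CoveredBy E a b → (∀ {f} → f ∈ E → f ∈ E') →
    Connected E' a b → IsConnected E'
  covered-connected {E} {E'} {a} {b} cover E⊆E' a~b x y = join (cover x) (cover y)
    where
    widen : ∀ {u w} → Connected E u w → Connected E' u w
    widen = connected-mono E⊆E'
    join : Connected E x a ⊎ Connected E x b → Connected E y a ⊎ Connected E y b → Connected E' x y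
    join (inj₁ x~a) (inj₁ y~a) = widen (x~a ◅◅ connected-sym y~a)
    join (inj₁ x~a) (inj₂ y~b) = widen x~a ◅◅ a~b ◅◅ widen (connected-sym y~b)
    join (inj₂ x~b) (inj₁ y~a) = widen x~b ◅◅ connected-sym a~b ◅◅ widen (connected-sym y~a)
    join (inj₂ x~b) (inj₂ y~b) = widen (x~b ◅◅ connected-sym y~b)

  bridge-joins : ∀ {E : List (Edge d)} {a b i j} → CoveredBy E a b → ¬ Connected E i j →
    Connected ((i , j) ∷ E) a b
  bridge-joins {E} {a} {b} {i} {j} cover i≁j = join (cover i) (cover j)
    where
    widen : ∀ {u w} → Connected E u w → Connected ((i , j) ∷ E) u w
    widen = connected-mono there
    join : Connected E i a ⊎ Connected E i b → Connected E j a ⊎ Connected E j b → Connected ((i , j) ∷ E) a b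
    join (inj₁ i~a) (inj₁ j~a) = contradiction (i~a ◅◅ connected-sym j~a) i≁j
    join (inj₁ i~a) (inj₂ j~b) = widen (connected-sym i~a) ◅◅ (inj₁ (here refl) ◅ widen j~b)
    join (inj₂ i~b) (inj₁ j~a) = widen (connected-sym j~a) ◅◅ (inj₂ (here refl) ◅ widen i~b)
    join (inj₂ i~b) (inj₂ j~b) = contradiction (i~b ◅◅ connected-sym j~b) i≁j

  augmented-independent : ∀ {V₁ V₂ : List (Edge d)} → suc (length V₁) ≡ d →
    (∀ {u} → u ∈ vecs V₂ → SpanDim (u ∷ vecs V₁) d) → ∀ {e} → e ∈ V₂ → EdgeIndependent (e ∷ V₁)
  augmented-independent {V₁} |V₁|+1≡d dim {e} e∈V₂ =
    independent-edges (subst (SpanDim (vecs (e ∷ V₁))) (sym |V₁|+1≡d) (dim (∈-map⁺ eVec e∈V₂)))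

  colour-class : ∀ (V₁ V₂ : List (Edge d)) → suc (length V₁) ≡ d → 0 <ℕ length V₂ →
    (∀ {u} → u ∈ vecs V₂ → SpanDim (u ∷ vecs V₁) d) →
    (Forest V₁ × TwoComponents V₁) ×
    (∀ {e} → e ∈ V₂ → Tree (e ∷ V₁)) ×
    (∀ {i j} → (i , j) ∈ V₂ → ¬ Connected V₁ i j)
  colour-class V₁ ((i₀ , j₀) ∷ V₂) |V₁|+1≡d _ dim =
    let a , b , cover = two-representatives V₁ |V₁|+1≡d V₁-independent
    in (independent-forest V₁-independent , a , b , a≁b cover , cover) , tree cover , bridges
    where
    with-edge : ∀ {e} → e ∈ (i₀ , j₀) ∷ V₂ → EdgeIndependent (e ∷ V₁)
    with-edge = augmented-independent {V₁} {(i₀ , j₀) ∷ V₂} |V₁|+1≡d dim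
    V₁-independent : EdgeIndependent V₁
    V₁-independent = independent-tail (with-edge (here refl))
    bridges : ∀ {i j} → (i , j) ∈ (i₀ , j₀) ∷ V₂ → ¬ Connected V₁ i j
    bridges e∈V₂ = independent-head (with-edge e∈V₂)
    a≁b : ∀ {a b} → CoveredBy V₁ a b → ¬ Connected V₁ a b
    a≁b cover a~b = bridges (here refl) (covered-connected cover id a~b i₀ j₀)
    tree : ∀ {a b} → CoveredBy V₁ a b → ∀ {e} → e ∈ (i₀ , j₀) ∷ V₂ → Tree (e ∷ V₁)
    tree cover e∈V₂ = covered-connected cover there (bridge-joins cover (bridges e∈V₂)) ,
                      independent-forest (with-edge e∈V₂)

mainTheorem11 : (d : ℕ) → 1 ≤ d → (VR VB : List (Edge d)) →
    InVd VR → InVd VB →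
    length VR ≡ d ∸ 1 → length VB ≡ d ∸ 1 →
    SpanDim (vecs VR) (d ∸ 1) → SpanDim (vecs VB) (d ∸ 1) →
    SpanDim (vecs (VR ++ VB)) d →
    Conjugate d (vecs VR) (vecs VB) →
    IsConnected (VR ++ VB) →
    (Forest VR × TwoComponents VR × Forest VB × TwoComponents VB) ×
    (∀ {eb} → eb ∈ VB → Tree (eb ∷ VR)) ×
    (∀ {er} → er ∈ VR → Tree (er ∷ VB)) ×
    (∀ {i j} → (i , j) ∈ VB → ¬ Connected VR i j) ×
    (∀ {i j} → (i , j) ∈ VR → ¬ Connected VB i j)
mainTheorem11 zero () _ _ _ _ _ _ _ _ _ _ _
mainTheorem11 (suc zero) _ (_ ∷ _) _  _ _ () _ _ _ _ _ _
mainTheorem11 (suc zero) _ []      (_ ∷ _) _ _ _ () _ _ _ _ _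
mainTheorem11 (suc zero) _ []      [] _ _ _ _ _ _ dimAll _ _ =
  contradiction (rank-bound {E = []} {E' = []} dimAll (λ ())) ℕP.1+n≰n
mainTheorem11 (suc (suc d)) _ VR VB _ _ |VR| |VB| _ _ _ (red⊕blue , blue⊕red) _ =
  let (forestR , twoR) , treesB , bridgesB = colour-class VR VB (cong suc |VR|) (nonempty {VB} |VB|) blue⊕red
      (forestB , twoB) , treesR , bridgesR = colour-class VB VR (cong suc |VB|) (nonempty {VR} |VR|) red⊕blue
  in (forestR , twoR , forestB , twoB) , treesB , treesR , bridgesB , bridgesR
  where
  nonempty : ∀ {V : List (Edge (suc (suc d)))} → length V ≡ suc d → 0 <ℕ length V
  nonempty |V| = subst (0 <ℕ_) (sym |V|) (s≤s z≤n)
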